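{- Let $r\ge0$ be an integer, let $F$ be a simple graph and let $H$ be an $(r+2)$-uniform hypergraph. Then \[ \hom(F_r,H)=\big(r!\,|V(H)|^r\big)^{|E(F)|}\,\hom(F,G[H]), \] where $F_r$ is the $r$-subdivision of $F$ and $G[H]$ is the codegree-section of $H$.
   Context: A hypergraph $H=(V,E)$ has edges that are nonempty subsets of $V$; it is $k$-uniform if every edge has exactly $k$ vertices. A homomorphism between hypergraphs $F\to H$ is a map $\varphi:V(F)\to V(H)$ with $\{\varphi(v):v\in e\}\in E(H)$ for every $e\in E(F)$; $\hom(F,H)$ is their number. The codegree of $u,v$ in $H$ is $\mathrm{codeg}_H(u,v)=|\{e\in E(H):\{u,v\}\subset e\}|$. For an $(r+2)$-uniform hypergraph $H$ on $N$ vertices, the codegree-section $G[H]$ is the weighted graph on $V(H)$ with adjacency matrix $A_{uv}=N^{ -r}\mathrm{codeg}_H(u,v)$ for $u\ne v$ and $A_{uu}=0$. For a weighted graph $G$ with adjacency matrix $A$, $\hom(F,G)=\sum_{\varphi:V(F)\to V(G)}\prod_{\{u,v\}\in E(F)}A_{\varphi(u)\varphi(v)}$. The $r$-subdivision $F_r$ of a graph $F$ is the $(r+2)$-uniform hypergraph obtained by replacing each edge $e=\{u,v\}\in E(F)$ by a hyperedge $h(e)=e\cup\{h_1(e),\dots,h_r(e)\}$, where the $h_i(e)$ are new vertices, pairwise distinct and distinct for different edges; $V(F_r)$ consists of $V(F)$ together with all these new vertices. -}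

module Defs where

open import Data.Nat as ℕ using (ℕ; zero; suc; _^_)
open import Data.Nat.Properties using (m^n≢0)
open import Data.Bool using (Bool; true; false; _∧_; _∨_; if_then_else_)
open import Data.Fin as Fin using (Fin; _↑ˡ_; _↑ʳ_; combine)
open import Data.Fin.Subset using (Subset; ⁅_⁆; _∪_; ⊥)
open import Data.Vec using (Vec; lookup; tabulate)
import Data.Vec.Properties as VecP
open import Data.List using (List; []; _∷_; map; foldr; length; concatMap; filterᵇ; allFin)
open import Data.Bool.ListAction using (all; any)
open import Data.List.Relation.Unary.All using (All)
open import Data.List.Relation.Unary.AllPairs using (AllPairs)
open import Data.Product using (_×_; _,_; proj₁; proj₂)
open import Data.Sum using (_⊎_)
open import Data.Integer using (+_)
open import Data.Rational as ℚ using (ℚ; _/_; 0ℚ; 1ℚ)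
open import Relation.Nullary using (¬_; does)
open import Relation.Binary.PropositionalEquality using (_≡_; _≢_)
import Data.Bool.Properties as BoolP
import Data.List.Membership.DecPropositional as DecMem

-- Hypergraphs: vertex set Fin nv, edge set given as a list of subsets.
-- (Being a *set* of edges = the list has no duplicates, see IsHypergraph.)

record Hypergraph : Set where
  field
    nv    : ℕ
    edges : List (Subset nv)
open Hypergraph public

card : ∀ {n} → Subset n → ℕ
card s = foldr (λ i k → if lookup s i then suc k else k) 0 (allFin _)

IsHypergraph : Hypergraph → Set
IsHypergraph H = All (λ e → ¬ (e ≡ ⊥)) (edges H) × AllPairs _≢_ (edges H)

Uniform : ℕ → Hypergraph → Set
Uniform k H = All (λ e → card e ≡ k) (edges H)

record SimpleGraph : Set where
  field
    gv      : ℕ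
    gedges  : List (Fin gv × Fin gv)
    loopless : All (λ e → proj₁ e ≢ proj₂ e) gedges
    nodup   : AllPairs (λ e f → ¬ ((proj₁ e ≡ proj₁ f × proj₂ e ≡ proj₂ f)
                                  ⊎ (proj₁ e ≡ proj₂ f × proj₂ e ≡ proj₁ f))) gedges
open SimpleGraph public

allFuns : (m N : ℕ) → List (Fin m → Fin N)
allFuns zero    N = (λ ()) ∷ []
allFuns (suc m) N =
  concatMap (λ f → map (λ i → λ { Fin.zero → i ; (Fin.suc k) → f k }) (allFin N))
            (allFuns m N)

image : ∀ {m N} → (Fin m → Fin N) → Subset m → Subset N
image {m} φ e = tabulate (λ i → any (λ j → lookup e j ∧ does (φ j Fin.≟ i)) (allFin m))

isHom : (F H : Hypergraph) → (Fin (nv F) → Fin (nv H)) → Bool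
isHom F H φ = all (λ e → does (DecMem._∈?_ (VecP.≡-dec {n = nv H} BoolP._≟_) (image φ e) (edges H))) (edges F)

homHyp : Hypergraph → Hypergraph → ℕ
homHyp F H = length (filterᵇ (isHom F H) (allFuns (nv F) (nv H)))

-- r-subdivision F_r of a simple graph F.
-- Vertices: Fin (gv F + |E(F)| * r); original vertex u is u ↑ˡ _,
-- the j-th new vertex of the i-th edge is gv F ↑ʳ combine i j.

fromList : ∀ {m} → List (Fin m) → Subset m
fromList = foldr (λ x s → ⁅ x ⁆ ∪ s) ⊥

subdivision : ℕ → SimpleGraph → Hypergraph
subdivision r F = record
  { nv    = gv F ℕ.+ length (gedges F) ℕ.* r
  ; edges = map hedge (allFin (length (gedges F)))
  }
  where
  hedge : Fin (length (gedges F)) → Subset (gv F ℕ.+ length (gedges F) ℕ.* r)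
  hedge i = fromList
    ( (proj₁ (Data.List.lookup (gedges F) i) ↑ˡ (length (gedges F) ℕ.* r))
    ∷ (proj₂ (Data.List.lookup (gedges F) i) ↑ˡ (length (gedges F) ℕ.* r))
    ∷ map (λ j → gv F ↑ʳ combine i j) (allFin r))

codeg : (H : Hypergraph) → Fin (nv H) → Fin (nv H) → ℕ
codeg H u v = length (filterᵇ (λ e → lookup e u ∧ lookup e v) (edges H))

sectionWeights : (N : ℕ) → ℕ → (Fin N → Fin N → ℕ) → Fin N → Fin N → ℚ
sectionWeights (suc n) r c u v =
  if does (u Fin.≟ v) then 0ℚ
  else _/_ (+ c u v) (suc n ^ r) {{m^n≢0 (suc n) r}}

codegSection : ℕ → (H : Hypergraph) → Fin (nv H) → Fin (nv H) → ℚ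
codegSection r H = sectionWeights (nv H) r (codeg H)

homW : (F : SimpleGraph) → (N : ℕ) → (Fin N → Fin N → ℚ) → ℚ
homW F N A =
  foldr ℚ._+_ 0ℚ
    (map (λ φ → foldr ℚ._*_ 1ℚ (map (λ e → A (φ (proj₁ e)) (φ (proj₂ e))) (gedges F)))
         (allFuns (gv F) N))

toℚ : ℕ → ℚ
toℚ n = (+ n) / 1

{-# OPTIONS --safe #-}
module Submission where

-- A map φ : V(F_r) → V(H) is a homomorphism iff, for every edge uv of F, the set
-- {φ u, φ v} ∪ φ(h_1(uv), …, h_r(uv)) is an edge of H. Splitting φ into its restriction ψ
-- to V(F) and the r-tuples c it assigns to the new vertices of each edge, the count
-- factorises over the edges of F:  hom(F_r, H) = Σ_ψ Π_{uv ∈ E(F)} X(ψ u, ψ v),  where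
-- X(a, b) is the number of c : [r] → V(H) with {a, b} ∪ range c ∈ E(H). As the edges of H
-- are distinct, X(a, b) = Σ_{e ∈ E(H)} #{c | {a, b} ∪ range c = e}, and since |e| = r + 2
-- this equation forces a ≠ b, a, b ∈ e and c to be a bijection onto e ∖ {a, b}. Peeling off
-- one point at a time (for |q| < |S|, {x} ∪ q = S iff x ∈ S and q = S ∖ {x}) there are k!
-- maps [k] → S onto a k-set S, so X(a, b) = r! codeg(a, b) for a ≠ b and X(a, a) = 0.
-- This is r! N^r times the adjacency matrix of G[H], and (r! N^r)^|E(F)| factors out.

open import Defs
open import Algebra.Bundles using (CommutativeMonoid)
import Algebra.Properties.CommutativeSemigroup as CommutativeSemigroupProperties
open import Data.Bool using (Bool; true; false; _∧_; if_then_else_; T)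
import Data.Bool.Properties as Bool
open import Data.Bool.Properties using (T-≡; T-∧)
open import Data.Bool.ListAction using (all)
open import Data.Fin as Fin using (Fin; zero; suc; _↑ˡ_; _↑ʳ_; combine; splitAt)
open import Data.Fin.Subset using (Subset; _∈_; _∉_; _⊆_; ⁅_⁆; _∪_; _─_; _-_; ∣_∣; ⊥; inside; outside)
open import Data.Fin.Subset.Properties
  using (_∈?_; x∈⁅x⁆; x∈⁅y⁆⇒x≡y; x∈p∪q⁺; x∈p∪q⁻; p─q⊆p; x∈p∧x≢y⇒x∈p-y; ∣⁅x⁆∣≡1; ∣⊥∣≡0;
         ∣p∣≤∣x∷p∣; p⊆q⇒∣p∣≤∣q∣; drop-∷-⊆; ∪-identityˡ; p─⊥≡p; ∉⊥; ⊆-antisym)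
import Data.Integer as ℤ
import Data.Integer.Properties as ℤ
open import Data.List as List
  using (List; []; _∷_; map; foldr; length; concatMap; filterᵇ; allFin; tabulate)
import Data.List.Properties as List
open import Data.List.Membership.Propositional using (lose) renaming (_∈_ to _∈ₗ_)
open import Data.List.Membership.Propositional.Properties using (∈-allFin; ∈-map⁺; ∈-map⁻)
import Data.List.Membership.DecPropositional as DecMembership
open import Data.List.Relation.Unary.All as All using (All; []; _∷_)
open import Data.List.Relation.Unary.AllPairs using (AllPairs; []; _∷_)
open import Data.List.Relation.Unary.Any using (here; there; satisfied)
open import Data.List.Relation.Unary.Any.Properties using (any⁺; any⁻)
open import Data.Nat using (ℕ; zero; suc; NonZero; _+_; _*_; _^_; _!; _≤_; _<_; z≤n; s≤s; s≤s⁻¹)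
open import Data.Nat.Properties
  using (+-identityʳ; +-assoc; +-comm; +-suc; *-zeroʳ; *-comm; *-assoc; *-distribˡ-+;
         +-monoʳ-≤; ≤-trans; ≤-reflexive; <-irrefl; suc-injective; +-commutativeSemigroup; m^n≢0)
open import Data.Nat.Solver using (module +-*-Solver)
open +-*-Solver using (solve; _:+_; _:*_; _:=_; con)
open import Data.Product using (_×_; _,_; proj₁; proj₂; ∃)
import Data.Rational
open import Data.Rational as ℚ using (ℚ; 0ℚ; 1ℚ; _/_; fromℚᵘ)
import Data.Rational.Properties as ℚ
open import Data.Rational.Unnormalised as ℚᵘ using (ℚᵘ; mkℚᵘ; *≡*)
import Data.Rational.Unnormalised.Properties as ℚᵘ
open import Data.Sum using (inj₁; inj₂)
open import Data.Vec using (_∷_; []; lookup; here; there)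
import Data.Vec.Properties as Vec
open import Data.Vec.Properties using ([]=⇒lookup; lookup⇒[]=)
open import Data.Vec.Functional using (_++_) renaming (_∷_ to _◂_)
open import Data.Vec.Functional.Properties using (lookup-++ˡ; lookup-++ʳ; ++-cong)
open import Function using (_∘_; id; _⇔_; mk⇔; Equivalence)
open import Relation.Binary.Core using (_Preserves_⟶_)
open import Relation.Binary.Definitions using (DecidableEquality)
open import Relation.Binary.PropositionalEquality
  using (_≡_; _≢_; _≗_; refl; sym; trans; cong; cong₂; subst; module ≡-Reasoning)
open import Relation.Nullary using (Dec; yes; no; does; contradiction)
open import Relation.Nullary.Decidable using (dec-true; dec-false)

𝟙 : Bool → ℕ
𝟙 b = if b then 1 else 0

𝟙-∧ : ∀ a b → 𝟙 (a ∧ b) ≡ 𝟙 a * 𝟙 b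
𝟙-∧ true  b = sym (+-identityʳ (𝟙 b))
𝟙-∧ false b = refl

𝟙-does-⇔ : ∀ {P Q : Set} → P ⇔ Q → (p? : Dec P) (q? : Dec Q) → 𝟙 (does p?) ≡ 𝟙 (does q?)
𝟙-does-⇔ P⇔Q p? q? = cong 𝟙 (does-⇔ p? q?)
  where
  open Equivalence P⇔Q
  does-⇔ : (p? : Dec _) (q? : Dec _) → does p? ≡ does q?
  does-⇔ (yes p) q? = sym (dec-true q? (to p))
  does-⇔ (no ¬p) q? = sym (dec-false q? (¬p ∘ from))

𝟙-does-*-cong : ∀ {P : Set} {m n} → (P → m ≡ n) → (p? : Dec P) → 𝟙 (does p?) * m ≡ 𝟙 (does p?) * n
𝟙-does-*-cong m≡n (yes p) = cong (_+ 0) (m≡n p)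
𝟙-does-*-cong m≡n (no _)  = refl

module _ {A : Set} where

  ∑ : List A → (A → ℕ) → ℕ
  ∑ []       f = 0
  ∑ (x ∷ xs) f = f x + ∑ xs f

  ∏ : List A → (A → ℕ) → ℕ
  ∏ []       f = 1
  ∏ (x ∷ xs) f = f x * ∏ xs f

  infix 5 ∑ ∏
  syntax ∑ xs (λ x → e) = ∑[ x ∈ xs ] e
  syntax ∏ xs (λ x → e) = ∏[ x ∈ xs ] e

  ∑-cong : ∀ xs {f g : A → ℕ} → f ≗ g → ∑ xs f ≡ ∑ xs g
  ∑-cong []       f≗g = refl
  ∑-cong (x ∷ xs) f≗g = cong₂ _+_ (f≗g x) (∑-cong xs f≗g)

  ∏-cong : ∀ xs {f g : A → ℕ} → f ≗ g → ∏ xs f ≡ ∏ xs g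
  ∏-cong []       f≗g = refl
  ∏-cong (x ∷ xs) f≗g = cong₂ _*_ (f≗g x) (∏-cong xs f≗g)

  ∑-cong-All : ∀ {P : A → Set} {xs} {f g : A → ℕ} →
    All P xs → (∀ {x} → P x → f x ≡ g x) → ∑ xs f ≡ ∑ xs g
  ∑-cong-All []         f≡g = refl
  ∑-cong-All (px ∷ pxs) f≡g = cong₂ _+_ (f≡g px) (∑-cong-All pxs f≡g)

  ∑-zero : ∀ {xs} {f : A → ℕ} → All (λ x → f x ≡ 0) xs → ∑ xs f ≡ 0
  ∑-zero []            = refl
  ∑-zero (fx≡0 ∷ fxs≡0) = cong₂ _+_ fx≡0 (∑-zero fxs≡0)

  ∑-distrib-+ : ∀ xs (f g : A → ℕ) → ∑[ x ∈ xs ] (f x + g x) ≡ ∑ xs f + ∑ xs g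
  ∑-distrib-+ []       f g = refl
  ∑-distrib-+ (x ∷ xs) f g =
    trans (cong (f x + g x +_) (∑-distrib-+ xs f g)) (interchange (f x) (g x) (∑ xs f) (∑ xs g))
    where open CommutativeSemigroupProperties +-commutativeSemigroup using (interchange)

  *-distribˡ-∑ : ∀ c xs (f : A → ℕ) → c * ∑ xs f ≡ ∑[ x ∈ xs ] c * f x
  *-distribˡ-∑ c []       f = *-zeroʳ c
  *-distribˡ-∑ c (x ∷ xs) f = trans (*-distribˡ-+ c (f x) _) (cong (c * f x +_) (*-distribˡ-∑ c xs f))

  *-distribʳ-∑ : ∀ c xs (f : A → ℕ) → ∑ xs f * c ≡ ∑[ x ∈ xs ] f x * c
  *-distribʳ-∑ c xs f =
    trans (*-comm (∑ xs f) c) (trans (*-distribˡ-∑ c xs f) (∑-cong xs λ x → *-comm c (f x)))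

  ∑-++ : ∀ xs ys (f : A → ℕ) → ∑ (xs List.++ ys) f ≡ ∑ xs f + ∑ ys f
  ∑-++ []       ys f = refl
  ∑-++ (x ∷ xs) ys f = trans (cong (f x +_) (∑-++ xs ys f)) (sym (+-assoc (f x) _ _))

  length-filterᵇ : ∀ (p : A → Bool) xs → length (filterᵇ p xs) ≡ ∑[ x ∈ xs ] 𝟙 (p x)
  length-filterᵇ p []       = refl
  length-filterᵇ p (x ∷ xs) with p x
  ... | true  = cong suc (length-filterᵇ p xs)
  ... | false = length-filterᵇ p xs

  𝟙-all : ∀ (p : A → Bool) xs → 𝟙 (all p xs) ≡ ∏[ x ∈ xs ] 𝟙 (p x)
  𝟙-all p []       = refl
  𝟙-all p (x ∷ xs) = trans (𝟙-∧ (p x) _) (cong (𝟙 (p x) *_) (𝟙-all p xs))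

module _ {A B : Set} where

  ∑-map : ∀ (h : A → B) xs (f : B → ℕ) → ∑ (map h xs) f ≡ ∑[ x ∈ xs ] f (h x)
  ∑-map h []       f = refl
  ∑-map h (x ∷ xs) f = cong (f (h x) +_) (∑-map h xs f)

  ∏-map : ∀ (h : A → B) xs (f : B → ℕ) → ∏ (map h xs) f ≡ ∏[ x ∈ xs ] f (h x)
  ∏-map h []       f = refl
  ∏-map h (x ∷ xs) f = cong (f (h x) *_) (∏-map h xs f)

  ∑-concatMap : ∀ (h : A → List B) xs (f : B → ℕ) → ∑ (concatMap h xs) f ≡ ∑[ x ∈ xs ] ∑ (h x) f
  ∑-concatMap h []       f = refl
  ∑-concatMap h (x ∷ xs) f = trans (∑-++ (h x) _ f) (cong (∑ (h x) f +_) (∑-concatMap h xs f))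

  ∑-swap : ∀ xs ys (f : A → B → ℕ) → ∑[ x ∈ xs ] ∑ ys (f x) ≡ ∑[ y ∈ ys ] ∑[ x ∈ xs ] f x y
  ∑-swap []       ys f = sym (∑-zero (All.universal (λ _ → refl) ys))
  ∑-swap (x ∷ xs) ys f =
    trans (cong (∑ ys (f x) +_) (∑-swap xs ys f)) (sym (∑-distrib-+ ys (f x) _))

∑-allFin-suc : ∀ n (f : Fin (suc n) → ℕ) →
  ∑ (allFin (suc n)) f ≡ f zero + (∑[ i ∈ allFin n ] f (suc i))
∑-allFin-suc n f = cong (f zero +_)
  (trans (cong (λ is → ∑ is f) (sym (List.map-tabulate id suc))) (∑-map suc (allFin n) f))

∏-allFin-suc : ∀ n (f : Fin (suc n) → ℕ) →
  ∏ (allFin (suc n)) f ≡ f zero * (∏[ i ∈ allFin n ] f (suc i))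
∏-allFin-suc n f = cong (f zero *_)
  (trans (cong (λ is → ∏ is f) (sym (List.map-tabulate id suc))) (∏-map suc (allFin n) f))

∏-allFin-lookup : ∀ {A : Set} (xs : List A) (f : A → ℕ) →
  ∏[ i ∈ allFin (length xs) ] f (List.lookup xs i) ≡ ∏ xs f
∏-allFin-lookup xs f = begin
  ∏[ i ∈ allFin (length xs) ] f (List.lookup xs i)
    ≡⟨ ∏-map (List.lookup xs) (allFin _) f ⟨
  ∏ (map (List.lookup xs) (allFin _)) f
    ≡⟨ cong (λ ys → ∏ ys f) (List.map-tabulate id (List.lookup xs)) ⟩
  ∏ (tabulate (List.lookup xs)) f
    ≡⟨ cong (λ ys → ∏ ys f) (List.tabulate-lookup xs) ⟩
  ∏ xs f
    ∎
  where open ≡-Reasoning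

-- Sums over all maps Fin m → Fin N

◂-++ : ∀ {m k N} (i : Fin N) (g : Fin m → Fin N) (h : Fin k → Fin N) → (i ◂ (g ++ h)) ≗ ((i ◂ g) ++ h)
◂-++     i g h zero    = refl
◂-++ {m} i g h (suc x) with splitAt m x
... | inj₁ _ = refl
... | inj₂ _ = refl

-- allFuns builds its maps with pattern-matching lambdas that are only pointwise equal to
-- i ◂ g, and there is no function extensionality: hence the hypotheses f Preserves _≗_ ⟶ _≡_.
∑-allFuns-suc : ∀ m N (f : (Fin (suc m) → Fin N) → ℕ) → f Preserves _≗_ ⟶ _≡_ →
  ∑ (allFuns (suc m) N) f ≡ ∑[ g ∈ allFuns m N ] ∑[ i ∈ allFin N ] f (i ◂ g)
∑-allFuns-suc m N f f-cong =
  trans (∑-concatMap _ (allFuns m N) f) (∑-cong (allFuns m N) λ g →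
  trans (∑-map _ (allFin N) f) (∑-cong (allFin N) λ i →
  f-cong λ { zero → refl ; (suc _) → refl }))

∑-allFuns-++ : ∀ m {k} N (f : (Fin (m + k) → Fin N) → ℕ) → f Preserves _≗_ ⟶ _≡_ →
  ∑ (allFuns (m + k) N) f ≡ ∑[ g ∈ allFuns m N ] ∑[ h ∈ allFuns k N ] f (g ++ h)
∑-allFuns-++ zero    N f f-cong = sym (+-identityʳ _)
∑-allFuns-++ (suc m) {k} N f f-cong = begin
  ∑ (allFuns (suc m + k) N) f
    ≡⟨ ∑-allFuns-suc (m + k) N f f-cong ⟩
  ∑[ φ ∈ allFuns (m + k) N ] ∑[ i ∈ allFin N ] f (i ◂ φ)
    ≡⟨ ∑-allFuns-++ m N _ (λ φ≗ψ → ∑-cong (allFin N) λ i → f-cong λ { zero → refl ; (suc x) → φ≗ψ x }) ⟩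
  ∑[ g ∈ allFuns m N ] ∑[ h ∈ allFuns k N ] ∑[ i ∈ allFin N ] f (i ◂ (g ++ h))
    ≡⟨ ∑-cong (allFuns m N) (λ g → ∑-swap (allFuns k N) (allFin N) _) ⟩
  ∑[ g ∈ allFuns m N ] ∑[ i ∈ allFin N ] ∑[ h ∈ allFuns k N ] f (i ◂ (g ++ h))
    ≡⟨ ∑-cong (allFuns m N) (λ g → ∑-cong (allFin N) λ i → ∑-cong (allFuns k N) λ h →
         f-cong (◂-++ i g h)) ⟩
  ∑[ g ∈ allFuns m N ] ∑[ i ∈ allFin N ] ∑[ h ∈ allFuns k N ] f ((i ◂ g) ++ h)
    ≡⟨ ∑-allFuns-suc m N _ (λ g≗g′ → ∑-cong (allFuns k N) λ h →
         f-cong (++-cong _ _ g≗g′ λ _ → refl)) ⟨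
  ∑[ g ∈ allFuns (suc m) N ] ∑[ h ∈ allFuns k N ] f (g ++ h)
    ∎
  where open ≡-Reasoning

∑-allFuns-combine : ∀ E r N (g : Fin E → (Fin r → Fin N) → ℕ) → (∀ i → g i Preserves _≗_ ⟶ _≡_) →
  ∑[ χ ∈ allFuns (E * r) N ] ∏[ i ∈ allFin E ] g i (λ j → χ (combine i j))
    ≡ ∏[ i ∈ allFin E ] ∑ (allFuns r N) (g i)
∑-allFuns-combine zero    r N g g-cong = refl
∑-allFuns-combine (suc E) r N g g-cong = begin
  ∑[ χ ∈ allFuns (r + E * r) N ] ∏[ i ∈ allFin (suc E) ] g i (λ j → χ (combine i j))
    ≡⟨ ∑-cong (allFuns (r + E * r) N) (λ χ → ∏-allFin-suc E (λ i → g i (λ j → χ (combine i j)))) ⟩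
  ∑[ χ ∈ allFuns (r + E * r) N ] g zero (λ j → χ (j ↑ˡ E * r)) * rest (λ x → χ (r ↑ʳ x))
    ≡⟨ ∑-allFuns-++ r N _ (λ χ≗χ′ →
         cong₂ _*_ (g-cong zero (χ≗χ′ ∘ (_↑ˡ E * r))) (rest-cong (χ≗χ′ ∘ (r ↑ʳ_)))) ⟩
  ∑[ c ∈ allFuns r N ] ∑[ χ ∈ allFuns (E * r) N ]
    g zero (λ j → (c ++ χ) (j ↑ˡ E * r)) * rest (λ x → (c ++ χ) (r ↑ʳ x))
    ≡⟨ ∑-cong (allFuns r N) (λ c → ∑-cong (allFuns (E * r) N) λ χ →
         cong₂ _*_ (g-cong zero (lookup-++ˡ c χ)) (rest-cong (lookup-++ʳ c χ))) ⟩
  ∑[ c ∈ allFuns r N ] ∑[ χ ∈ allFuns (E * r) N ] g zero c * rest χ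
    ≡⟨ ∑-cong (allFuns r N) (λ c → *-distribˡ-∑ (g zero c) (allFuns (E * r) N) rest) ⟨
  ∑[ c ∈ allFuns r N ] g zero c * ∑ (allFuns (E * r) N) rest
    ≡⟨ *-distribʳ-∑ _ (allFuns r N) (g zero) ⟨
  ∑ (allFuns r N) (g zero) * ∑ (allFuns (E * r) N) rest
    ≡⟨ cong (∑ (allFuns r N) (g zero) *_) (∑-allFuns-combine E r N (g ∘ suc) (g-cong ∘ suc)) ⟩
  ∑ (allFuns r N) (g zero) * (∏[ i ∈ allFin E ] ∑ (allFuns r N) (g (suc i)))
    ≡⟨ ∏-allFin-suc E (λ i → ∑ (allFuns r N) (g i)) ⟨
  ∏[ i ∈ allFin (suc E) ] ∑ (allFuns r N) (g i)
    ∎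
  where
  open ≡-Reasoning
  rest : (Fin (E * r) → Fin N) → ℕ
  rest χ = ∏[ i ∈ allFin E ] g (suc i) (λ j → χ (combine i j))
  rest-cong : rest Preserves _≗_ ⟶ _≡_
  rest-cong χ≗χ′ = ∏-cong (allFin E) λ i → g-cong (suc i) λ j → χ≗χ′ (combine i j)

infix 4 _≟ˢ_
_≟ˢ_ : ∀ {n} → DecidableEquality (Subset n)
_≟ˢ_ = Vec.≡-dec Bool._≟_

card-∷ : ∀ {n} s (p : Subset n) → card (s ∷ p) ≡ (if s then suc (card p) else card p)
card-∷ {n} s p = cong (λ k → if s then suc k else k) (begin
  foldr step 0 (tabulate Fin.suc)        ≡⟨ cong (foldr step 0) (List.map-tabulate id Fin.suc) ⟨
  foldr step 0 (map Fin.suc (allFin n))  ≡⟨ List.foldr-map step Fin.suc 0 (allFin n) ⟩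
  card p                                 ∎)
  where
  open ≡-Reasoning
  step : Fin (suc n) → ℕ → ℕ
  step i k = if lookup (s ∷ p) i then suc k else k

card≡∣∣ : ∀ {n} (p : Subset n) → card p ≡ ∣ p ∣
card≡∣∣ []            = refl
card≡∣∣ (inside ∷ p)  = trans (card-∷ inside p) (cong suc (card≡∣∣ p))
card≡∣∣ (outside ∷ p) = trans (card-∷ outside p) (card≡∣∣ p)

∑-∈?≡∣∣ : ∀ {n} (p : Subset n) → ∑[ x ∈ allFin n ] 𝟙 (does (x ∈? p)) ≡ ∣ p ∣
∑-∈?≡∣∣         []            = refl
∑-∈?≡∣∣ {suc n} (inside ∷ p)  =
  trans (∑-allFin-suc n λ x → 𝟙 (does (x ∈? inside ∷ p))) (cong suc (∑-∈?≡∣∣ p))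
∑-∈?≡∣∣ {suc n} (outside ∷ p) =
  trans (∑-allFin-suc n λ x → 𝟙 (does (x ∈? outside ∷ p))) (∑-∈?≡∣∣ p)

does-∈?≡lookup : ∀ {n} (x : Fin n) (p : Subset n) → does (x ∈? p) ≡ lookup p x
does-∈?≡lookup zero    (inside  ∷ p) = refl
does-∈?≡lookup zero    (outside ∷ p) = refl
does-∈?≡lookup (suc x) (s ∷ p)       = does-∈?≡lookup x p

∣p∪q∣≤∣p∣+∣q∣ : ∀ {n} (p q : Subset n) → ∣ p ∪ q ∣ ≤ ∣ p ∣ + ∣ q ∣
∣p∪q∣≤∣p∣+∣q∣ []            []            = z≤n
∣p∪q∣≤∣p∣+∣q∣ (inside  ∷ p) (t ∷ q)       =
  s≤s (≤-trans (∣p∪q∣≤∣p∣+∣q∣ p q) (+-monoʳ-≤ ∣ p ∣ (∣p∣≤∣x∷p∣ t q)))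
∣p∪q∣≤∣p∣+∣q∣ (outside ∷ p) (inside  ∷ q) =
  ≤-trans (s≤s (∣p∪q∣≤∣p∣+∣q∣ p q)) (≤-reflexive (sym (+-suc ∣ p ∣ ∣ q ∣)))
∣p∪q∣≤∣p∣+∣q∣ (outside ∷ p) (outside ∷ q) = ∣p∪q∣≤∣p∣+∣q∣ p q

∣⁅x⁆∪p∣≤suc∣p∣ : ∀ {n} (x : Fin n) p → ∣ ⁅ x ⁆ ∪ p ∣ ≤ suc ∣ p ∣
∣⁅x⁆∪p∣≤suc∣p∣ x p = ≤-trans (∣p∪q∣≤∣p∣+∣q∣ ⁅ x ⁆ p) (≤-reflexive (cong (_+ ∣ p ∣) (∣⁅x⁆∣≡1 x)))

∣fromList∣≤length : ∀ {n} (xs : List (Fin n)) → ∣ fromList xs ∣ ≤ length xs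
∣fromList∣≤length {n} []       = ≤-reflexive (∣⊥∣≡0 n)
∣fromList∣≤length     (x ∷ xs) = ≤-trans (∣⁅x⁆∪p∣≤suc∣p∣ x _) (s≤s (∣fromList∣≤length xs))

range : ∀ {k n} → (Fin k → Fin n) → Subset n
range c = fromList (tabulate c)

range-cong : ∀ {k n} {c c′ : Fin k → Fin n} → c ≗ c′ → range c ≡ range c′
range-cong c≗c′ = cong fromList (List.tabulate-cong c≗c′)

∣range∣≤k : ∀ {k n} (c : Fin k → Fin n) → ∣ range c ∣ ≤ k
∣range∣≤k c = ≤-trans (∣fromList∣≤length (tabulate c)) (≤-reflexive (List.length-tabulate c))

x∈p─q⇒x∉q : ∀ {n} {x : Fin n} (p q : Subset n) → x ∈ p ─ q → x ∉ q
x∈p─q⇒x∉q (s ∷ p) (inside ∷ q) ()             here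
x∈p─q⇒x∉q (s ∷ p) (t ∷ q)      (there x∈p─q) (there x∈q) = x∈p─q⇒x∉q p q x∈p─q x∈q

∣p∣≡suc∣p-x∣ : ∀ {n} {x : Fin n} {p : Subset n} → x ∈ p → ∣ p ∣ ≡ suc ∣ p - x ∣
∣p∣≡suc∣p-x∣ {p = inside ∷ p}  here        = cong (suc ∘ ∣_∣) (sym (p─⊥≡p p))
∣p∣≡suc∣p-x∣ {p = inside ∷ p}  (there x∈p) = cong suc (∣p∣≡suc∣p-x∣ x∈p)
∣p∣≡suc∣p-x∣ {p = outside ∷ p} (there x∈p) = ∣p∣≡suc∣p-x∣ x∈p

∣p∣≡suc[k]⇒∣p-x∣≡k : ∀ {n k} {x : Fin n} {p : Subset n} → x ∈ p → ∣ p ∣ ≡ suc k → ∣ p - x ∣ ≡ k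
∣p∣≡suc[k]⇒∣p-x∣≡k x∈p ∣p∣≡1+k = suc-injective (trans (sym (∣p∣≡suc∣p-x∣ x∈p)) ∣p∣≡1+k)

p⊆q⇒∣q∣≤∣p∣⇒p≡q : ∀ {n} {p q : Subset n} → p ⊆ q → ∣ q ∣ ≤ ∣ p ∣ → p ≡ q
p⊆q⇒∣q∣≤∣p∣⇒p≡q {p = []}          {[]}          _   _        = refl
p⊆q⇒∣q∣≤∣p∣⇒p≡q {p = outside ∷ p} {outside ∷ q} p⊆q ∣q∣≤∣p∣ =
  cong (outside ∷_) (p⊆q⇒∣q∣≤∣p∣⇒p≡q (drop-∷-⊆ p⊆q) ∣q∣≤∣p∣)
p⊆q⇒∣q∣≤∣p∣⇒p≡q {p = outside ∷ p} {inside  ∷ q} p⊆q ∣q∣≤∣p∣ =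
  contradiction (≤-trans ∣q∣≤∣p∣ (p⊆q⇒∣p∣≤∣q∣ (drop-∷-⊆ p⊆q))) (<-irrefl refl)
p⊆q⇒∣q∣≤∣p∣⇒p≡q {p = inside  ∷ p} {outside ∷ q} p⊆q ∣q∣≤∣p∣ = contradiction (p⊆q here) λ ()
p⊆q⇒∣q∣≤∣p∣⇒p≡q {p = inside  ∷ p} {inside  ∷ q} p⊆q ∣q∣≤∣p∣ =
  cong (inside ∷_) (p⊆q⇒∣q∣≤∣p∣⇒p≡q (drop-∷-⊆ p⊆q) (s≤s⁻¹ ∣q∣≤∣p∣))

⁅x⁆∪p-x≡p : ∀ {n} {x : Fin n} {p : Subset n} → x ∈ p → ⁅ x ⁆ ∪ (p - x) ≡ p
⁅x⁆∪p-x≡p {p = inside ∷ p} here        = cong (inside ∷_) (trans (∪-identityˡ (p ─ ⊥)) (p─⊥≡p p))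
⁅x⁆∪p-x≡p {p = s ∷ p}      (there x∈p) = cong (s ∷_) (⁅x⁆∪p-x≡p x∈p)

⁅x⁆∪q≡p⇔q≡p-x : ∀ {n} {x : Fin n} {p q : Subset n} →
  x ∈ p → ∣ q ∣ < ∣ p ∣ → (⁅ x ⁆ ∪ q ≡ p) ⇔ (q ≡ p - x)
⁅x⁆∪q≡p⇔q≡p-x {x = x} {p} {q} x∈p ∣q∣<∣p∣ = mk⇔ to (λ { refl → ⁅x⁆∪p-x≡p x∈p })
  where
  to : ⁅ x ⁆ ∪ q ≡ p → q ≡ p - x
  to refl = sym (p⊆q⇒∣q∣≤∣p∣⇒p≡q p-x⊆q (s≤s⁻¹ (subst (∣ q ∣ <_) (∣p∣≡suc∣p-x∣ x∈p) ∣q∣<∣p∣)))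
    where
    p-x⊆q : p - x ⊆ q
    p-x⊆q y∈p-x with x∈p∪q⁻ ⁅ x ⁆ q (p─q⊆p p ⁅ x ⁆ y∈p-x)
    ... | inj₁ y∈⁅x⁆ = contradiction y∈⁅x⁆ (x∈p─q⇒x∉q p ⁅ x ⁆ y∈p-x)
    ... | inj₂ y∈q   = y∈q

x∉p⇒⁅x⁆∪q≢p : ∀ {n} {x : Fin n} {p q : Subset n} → x ∉ p → ⁅ x ⁆ ∪ q ≢ p
x∉p⇒⁅x⁆∪q≢p {x = x} x∉p refl = x∉p (x∈p∪q⁺ (inj₁ (x∈⁅x⁆ x)))

module _ {n : ℕ} {x : Fin n} where

  ∈-fromList⁺ : ∀ {xs} → x ∈ₗ xs → x ∈ fromList xs
  ∈-fromList⁺ (here refl)  = x∈p∪q⁺ (inj₁ (x∈⁅x⁆ x))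
  ∈-fromList⁺ (there x∈xs) = x∈p∪q⁺ (inj₂ (∈-fromList⁺ x∈xs))

  ∈-fromList⁻ : ∀ xs → x ∈ fromList xs → x ∈ₗ xs
  ∈-fromList⁻ []       x∈⊥ = contradiction x∈⊥ ∉⊥
  ∈-fromList⁻ (y ∷ xs) x∈  with x∈p∪q⁻ ⁅ y ⁆ (fromList xs) x∈
  ... | inj₁ x∈⁅y⁆ = here (x∈⁅y⁆⇒x≡y y x∈⁅y⁆)
  ... | inj₂ x∈xs  = there (∈-fromList⁻ xs x∈xs)

module _ {m n : ℕ} (φ : Fin m → Fin n) {s : Subset m} where

  open Equivalence

  ∈-image⁻ : ∀ {y} → y ∈ image φ s → ∃ λ x → x ∈ s × φ x ≡ y
  ∈-image⁻ {y} y∈ with satisfied (any⁻ _ (allFin m)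
                         (from T-≡ (trans (sym (Vec.lookup∘tabulate _ y)) ([]=⇒lookup y∈))))
  ... | x , T[x∈s∧φx≡y] with to T-∧ T[x∈s∧φx≡y]
  ... | T[x∈s] , T[φx≡y] = x , lookup⇒[]= x s (to T-≡ T[x∈s]) , T-does⇒ (φ x Fin.≟ y) T[φx≡y]
    where
    T-does⇒ : ∀ {P : Set} (P? : Dec P) → T (does P?) → P
    T-does⇒ (yes p) _ = p

  ∈-image⁺ : ∀ {x} → x ∈ s → φ x ∈ image φ s
  ∈-image⁺ {x} x∈s = lookup⇒[]= (φ x) (image φ s) (trans (Vec.lookup∘tabulate _ (φ x))
    (to T-≡ (any⁺ _ (lose (∈-allFin x)
      (from T-∧ (from T-≡ ([]=⇒lookup x∈s) , from T-≡ (dec-true (φ x Fin.≟ φ x) refl)))))))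

image-fromList : ∀ {m n} (φ : Fin m → Fin n) xs → image φ (fromList xs) ≡ fromList (map φ xs)
image-fromList φ xs = ⊆-antisym image⊆ ⊆image
  where
  image⊆ : image φ (fromList xs) ⊆ fromList (map φ xs)
  image⊆ y∈ with ∈-image⁻ φ y∈
  ... | x , x∈ , refl = ∈-fromList⁺ (∈-map⁺ φ (∈-fromList⁻ xs x∈))
  ⊆image : fromList (map φ xs) ⊆ image φ (fromList xs)
  ⊆image y∈ with ∈-map⁻ φ (∈-fromList⁻ (map φ xs) y∈)
  ... | x , x∈xs , refl = ∈-image⁺ φ (∈-fromList⁺ x∈xs)

-- Counting maps by their range

∑-⁅x⁆∪q≡p : ∀ {C : Set} {n} (x : Fin n) (p : Subset n) (cs : List C) (q : C → Subset n) →
  (∀ c → ∣ q c ∣ < ∣ p ∣) →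
  ∑[ c ∈ cs ] 𝟙 (does (⁅ x ⁆ ∪ q c ≟ˢ p)) ≡ 𝟙 (does (x ∈? p)) * (∑[ c ∈ cs ] 𝟙 (does (q c ≟ˢ p - x)))
∑-⁅x⁆∪q≡p x p cs q ∣q∣<∣p∣ with x ∈? p
... | yes x∈p = trans
  (∑-cong cs λ c → 𝟙-does-⇔ (⁅x⁆∪q≡p⇔q≡p-x {q = q c} x∈p (∣q∣<∣p∣ c)) (⁅ x ⁆ ∪ q c ≟ˢ p) (q c ≟ˢ p - x))
  (sym (+-identityʳ _))
... | no  x∉p = ∑-zero (All.universal (λ c → cong 𝟙 (dec-false (⁅ x ⁆ ∪ q c ≟ˢ p) (x∉p⇒⁅x⁆∪q≢p x∉p))) cs)

count-range≡p : ∀ k {n} (p : Subset n) → ∣ p ∣ ≡ k → ∑[ c ∈ allFuns k n ] 𝟙 (does (range c ≟ˢ p)) ≡ k !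

count-⁅x⁆∪range≡p : ∀ k {n} (x : Fin n) (p : Subset n) → ∣ p ∣ ≡ suc k →
  ∑[ c ∈ allFuns k n ] 𝟙 (does (⁅ x ⁆ ∪ range c ≟ˢ p)) ≡ 𝟙 (does (x ∈? p)) * k !

count-range≡p zero    p ∣p∣≡0 = cong (λ b → 𝟙 b + 0) (dec-true (⊥ ≟ˢ p) ⊥≡p)
  where
  ⊥≡p : ⊥ ≡ p
  ⊥≡p = p⊆q⇒∣q∣≤∣p∣⇒p≡q (λ x∈⊥ → contradiction x∈⊥ ∉⊥) (≤-trans (≤-reflexive ∣p∣≡0) z≤n)
count-range≡p (suc k) {n} p ∣p∣≡1+k = begin
  ∑[ c ∈ allFuns (suc k) n ] 𝟙 (does (range c ≟ˢ p))
    ≡⟨ ∑-allFuns-suc k n _ (λ c≗c′ → cong (λ q → 𝟙 (does (q ≟ˢ p))) (range-cong c≗c′)) ⟩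
  ∑[ c ∈ allFuns k n ] ∑[ x ∈ allFin n ] 𝟙 (does (⁅ x ⁆ ∪ range c ≟ˢ p))
    ≡⟨ ∑-swap (allFuns k n) (allFin n) _ ⟩
  ∑[ x ∈ allFin n ] ∑[ c ∈ allFuns k n ] 𝟙 (does (⁅ x ⁆ ∪ range c ≟ˢ p))
    ≡⟨ ∑-cong (allFin n) (λ x → count-⁅x⁆∪range≡p k x p ∣p∣≡1+k) ⟩
  ∑[ x ∈ allFin n ] 𝟙 (does (x ∈? p)) * k !
    ≡⟨ *-distribʳ-∑ (k !) (allFin n) _ ⟨
  (∑[ x ∈ allFin n ] 𝟙 (does (x ∈? p))) * k !
    ≡⟨ cong (_* k !) (trans (∑-∈?≡∣∣ p) ∣p∣≡1+k) ⟩
  suc k ! ∎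
  where open ≡-Reasoning

count-⁅x⁆∪range≡p k {n} x p ∣p∣≡1+k = trans
  (∑-⁅x⁆∪q≡p x p (allFuns k n) range (λ c → ≤-trans (s≤s (∣range∣≤k c)) (≤-reflexive (sym ∣p∣≡1+k))))
  (𝟙-does-*-cong (λ x∈p → count-range≡p k (p - x) (∣p∣≡suc[k]⇒∣p-x∣≡k x∈p ∣p∣≡1+k)) (x ∈? p))

count-⁅x⁆∪⁅y⁆∪range≡p : ∀ k {n} (x y : Fin n) (p : Subset n) → ∣ p ∣ ≡ suc (suc k) →
  ∑[ c ∈ allFuns k n ] 𝟙 (does (⁅ x ⁆ ∪ (⁅ y ⁆ ∪ range c) ≟ˢ p))
    ≡ 𝟙 (does (x ∈? p)) * (𝟙 (does (y ∈? p - x)) * k !)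
count-⁅x⁆∪⁅y⁆∪range≡p k {n} x y p ∣p∣≡2+k = trans
  (∑-⁅x⁆∪q≡p x p (allFuns k n) (λ c → ⁅ y ⁆ ∪ range c) ∣⁅y⁆∪range∣<∣p∣)
  (𝟙-does-*-cong (λ x∈p → count-⁅x⁆∪range≡p k y (p - x) (∣p∣≡suc[k]⇒∣p-x∣≡k x∈p ∣p∣≡2+k)) (x ∈? p))
  where
  ∣⁅y⁆∪range∣<∣p∣ : ∀ c → ∣ ⁅ y ⁆ ∪ range c ∣ < ∣ p ∣
  ∣⁅y⁆∪range∣<∣p∣ c =
    ≤-trans (s≤s (≤-trans (∣⁅x⁆∪p∣≤suc∣p∣ y (range c)) (s≤s (∣range∣≤k c)))) (≤-reflexive (sym ∣p∣≡2+k))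

-- Counting extensions of a pair of vertices to an edge

module _ {A : Set} (_≟_ : DecidableEquality A) where

  open DecMembership _≟_ using () renaming (_∈?_ to _∈ₗ?_)

  𝟙-∈ₗ?≡∑𝟙-≟ : ∀ x {ys} → AllPairs _≢_ ys → 𝟙 (does (x ∈ₗ? ys)) ≡ ∑[ y ∈ ys ] 𝟙 (does (x ≟ y))
  𝟙-∈ₗ?≡∑𝟙-≟ x                 []                = refl
  𝟙-∈ₗ?≡∑𝟙-≟ x {y ∷ ys} (y∉ys ∷ distinct) with x ≟ y
  ... | yes refl = cong suc (sym (∑-zero (All.map (λ x≢z → cong 𝟙 (dec-false (x ≟ _) x≢z)) y∉ys)))
  ... | no  _    = 𝟙-∈ₗ?≡∑𝟙-≟ x distinct

inEdges : (H : Hypergraph) → Subset (nv H) → ℕ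
inEdges H s = 𝟙 (does (s ∈ₗ? edges H))
  where open DecMembership _≟ˢ_ using () renaming (_∈?_ to _∈ₗ?_)

offDiagonal : ∀ {n} → (Fin n → Fin n → ℕ) → Fin n → Fin n → ℕ
offDiagonal c a b = if does (a Fin.≟ b) then 0 else c a b

∑-𝟙[a∈e]*𝟙[b∈e-a]≡codeg : ∀ (H : Hypergraph) a b →
  ∑[ e ∈ edges H ] 𝟙 (does (a ∈? e)) * 𝟙 (does (b ∈? e - a)) ≡ offDiagonal (codeg H) a b
∑-𝟙[a∈e]*𝟙[b∈e-a]≡codeg H a b with a Fin.≟ b
... | yes refl = ∑-zero (All.universal (λ e →
        trans (cong (λ t → 𝟙 (does (a ∈? e)) * 𝟙 t) (dec-false (a ∈? e - a) (a∉e-a e)))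
              (*-zeroʳ (𝟙 (does (a ∈? e)))))
      (edges H))
  where
  a∉e-a : ∀ e → a ∉ e - a
  a∉e-a e a∈e-a = x∈p─q⇒x∉q e ⁅ a ⁆ a∈e-a (x∈⁅x⁆ a)
... | no a≢b = begin
  ∑[ e ∈ edges H ] 𝟙 (does (a ∈? e)) * 𝟙 (does (b ∈? e - a))
    ≡⟨ ∑-cong (edges H) (λ e → cong (𝟙 (does (a ∈? e)) *_) (𝟙-does-⇔ (b∈e-a⇔b∈e e) (b ∈? e - a) (b ∈? e))) ⟩
  ∑[ e ∈ edges H ] 𝟙 (does (a ∈? e)) * 𝟙 (does (b ∈? e))
    ≡⟨ ∑-cong (edges H) (λ e → trans (cong₂ (λ s t → 𝟙 s * 𝟙 t) (does-∈?≡lookup a e) (does-∈?≡lookup b e))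
                                     (sym (𝟙-∧ (lookup e a) (lookup e b)))) ⟩
  ∑[ e ∈ edges H ] 𝟙 (lookup e a ∧ lookup e b)
    ≡⟨ length-filterᵇ _ (edges H) ⟨
  codeg H a b ∎
  where
  open ≡-Reasoning
  b∈e-a⇔b∈e : ∀ e → b ∈ e - a ⇔ b ∈ e
  b∈e-a⇔b∈e e = mk⇔ (p─q⊆p e ⁅ a ⁆) (λ b∈e → x∈p∧x≢y⇒x∈p-y b∈e (a≢b ∘ sym))

∑-inEdges≡codeg*r! : ∀ r (H : Hypergraph) → IsHypergraph H → Uniform (r + 2) H → ∀ a b →
  ∑[ c ∈ allFuns r (nv H) ] inEdges H (⁅ a ⁆ ∪ (⁅ b ⁆ ∪ range c)) ≡ offDiagonal (codeg H) a b * r !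
∑-inEdges≡codeg*r! r H (_ , distinct) uniform a b = begin
  ∑[ c ∈ allFuns r (nv H) ] inEdges H (⁅ a ⁆ ∪ (⁅ b ⁆ ∪ range c))
    ≡⟨ ∑-cong (allFuns r (nv H)) (λ c → 𝟙-∈ₗ?≡∑𝟙-≟ _≟ˢ_ _ distinct) ⟩
  ∑[ c ∈ allFuns r (nv H) ] ∑[ e ∈ edges H ] 𝟙 (does (⁅ a ⁆ ∪ (⁅ b ⁆ ∪ range c) ≟ˢ e))
    ≡⟨ ∑-swap (allFuns r (nv H)) (edges H) _ ⟩
  ∑[ e ∈ edges H ] ∑[ c ∈ allFuns r (nv H) ] 𝟙 (does (⁅ a ⁆ ∪ (⁅ b ⁆ ∪ range c) ≟ˢ e))
    ≡⟨ ∑-cong-All uniform (λ {e} card≡r+2 →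
         count-⁅x⁆∪⁅y⁆∪range≡p r a b e (trans (sym (card≡∣∣ e)) (trans card≡r+2 (+-comm r 2)))) ⟩
  ∑[ e ∈ edges H ] 𝟙 (does (a ∈? e)) * (𝟙 (does (b ∈? e - a)) * r !)
    ≡⟨ ∑-cong (edges H) (λ e → *-assoc (𝟙 (does (a ∈? e))) (𝟙 (does (b ∈? e - a))) (r !)) ⟨
  ∑[ e ∈ edges H ] 𝟙 (does (a ∈? e)) * 𝟙 (does (b ∈? e - a)) * r !
    ≡⟨ *-distribʳ-∑ (r !) (edges H) _ ⟨
  (∑[ e ∈ edges H ] 𝟙 (does (a ∈? e)) * 𝟙 (does (b ∈? e - a))) * r !
    ≡⟨ cong (_* r !) (∑-𝟙[a∈e]*𝟙[b∈e-a]≡codeg H a b) ⟩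
  offDiagonal (codeg H) a b * r ! ∎
  where open ≡-Reasoning

-- Homomorphisms from the subdivision

homWℕ : (F : SimpleGraph) (N : ℕ) → (Fin N → Fin N → ℕ) → ℕ
homWℕ F N w = ∑[ ψ ∈ allFuns (gv F) N ] ∏[ e ∈ gedges F ] w (ψ (proj₁ e)) (ψ (proj₂ e))

module _ (r : ℕ) (F : SimpleGraph) (H : Hypergraph) where

  private
    n = gv F
    E = length (gedges F)
    N = nv H

    u v : Fin E → Fin n
    u i = proj₁ (List.lookup (gedges F) i)
    v i = proj₂ (List.lookup (gedges F) i)

    edgeThrough : Fin N → Fin N → (Fin r → Fin N) → ℕ
    edgeThrough a b c = inEdges H (⁅ a ⁆ ∪ (⁅ b ⁆ ∪ range c))

    edgeThrough-cong : ∀ a b → edgeThrough a b Preserves _≗_ ⟶ _≡_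
    edgeThrough-cong a b c≗c′ = cong (λ s → inEdges H (⁅ a ⁆ ∪ (⁅ b ⁆ ∪ s))) (range-cong c≗c′)

  𝟙-isHom-subdivision : ∀ φ → 𝟙 (isHom (subdivision r F) H φ)
    ≡ ∏[ i ∈ allFin E ] edgeThrough (φ (u i ↑ˡ E * r)) (φ (v i ↑ˡ E * r)) (λ j → φ (n ↑ʳ combine i j))
  𝟙-isHom-subdivision φ =
    trans (𝟙-all _ (edges (subdivision r F)))
    (trans (∏-map _ (allFin E) _)
    (∏-cong (allFin E) λ i → cong (inEdges H) (trans (image-fromList φ (hyperedge i))
      (cong (λ xs → fromList (φ (u i ↑ˡ E * r) ∷ φ (v i ↑ˡ E * r) ∷ xs))
        (trans (sym (List.map-∘ {g = φ} (allFin r))) (List.map-tabulate id λ j → φ (n ↑ʳ combine i j)))))))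
    where
    hyperedge : Fin E → List (Fin (n + E * r))
    hyperedge i = (u i ↑ˡ E * r) ∷ (v i ↑ˡ E * r) ∷ map (λ j → n ↑ʳ combine i j) (allFin r)

  homHyp-subdivision : IsHypergraph H → Uniform (r + 2) H →
    homHyp (subdivision r F) H ≡ homWℕ F N (λ a b → offDiagonal (codeg H) a b * r !)
  homHyp-subdivision isH uniform = begin
    homHyp (subdivision r F) H
      ≡⟨ length-filterᵇ _ (allFuns (n + E * r) N) ⟩
    ∑[ φ ∈ allFuns (n + E * r) N ] 𝟙 (isHom (subdivision r F) H φ)
      ≡⟨ ∑-cong (allFuns (n + E * r) N) 𝟙-isHom-subdivision ⟩
    ∑[ φ ∈ allFuns (n + E * r) N ] hyperedgesIn φ
      ≡⟨ ∑-allFuns-++ n N hyperedgesIn hyperedgesIn-cong ⟩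
    ∑[ ψ ∈ allFuns n N ] ∑[ χ ∈ allFuns (E * r) N ] hyperedgesIn (ψ ++ χ)
      ≡⟨ ∑-cong (allFuns n N) (λ ψ → ∑-cong (allFuns (E * r) N) λ χ → ∏-cong (allFin E) λ i →
           trans (cong₂ (λ a b → edgeThrough a b λ j → (ψ ++ χ) (n ↑ʳ combine i j))
                        (lookup-++ˡ ψ χ (u i)) (lookup-++ˡ ψ χ (v i)))
                 (edgeThrough-cong (ψ (u i)) (ψ (v i)) (λ j → lookup-++ʳ ψ χ (combine i j)))) ⟩
    ∑[ ψ ∈ allFuns n N ] ∑[ χ ∈ allFuns (E * r) N ] ∏[ i ∈ allFin E ]
      edgeThrough (ψ (u i)) (ψ (v i)) (λ j → χ (combine i j))
      ≡⟨ ∑-cong (allFuns n N) (λ ψ → ∑-allFuns-combine E r N (λ i → edgeThrough (ψ (u i)) (ψ (v i)))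
                                                             (λ i → edgeThrough-cong (ψ (u i)) (ψ (v i)))) ⟩
    ∑[ ψ ∈ allFuns n N ] ∏[ i ∈ allFin E ] ∑ (allFuns r N) (edgeThrough (ψ (u i)) (ψ (v i)))
      ≡⟨ ∑-cong (allFuns n N) (λ ψ → ∏-cong (allFin E) λ i →
           ∑-inEdges≡codeg*r! r H isH uniform (ψ (u i)) (ψ (v i))) ⟩
    ∑[ ψ ∈ allFuns n N ] ∏[ i ∈ allFin E ] w (ψ (u i)) (ψ (v i))
      ≡⟨ ∑-cong (allFuns n N) (λ ψ → ∏-allFin-lookup (gedges F) λ e → w (ψ (proj₁ e)) (ψ (proj₂ e))) ⟩
    homWℕ F N w ∎
    where
    open ≡-Reasoning
    w : Fin N → Fin N → ℕ
    w a b = offDiagonal (codeg H) a b * r !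
    hyperedgesIn : (Fin (n + E * r) → Fin N) → ℕ
    hyperedgesIn φ =
      ∏[ i ∈ allFin E ] edgeThrough (φ (u i ↑ˡ E * r)) (φ (v i ↑ˡ E * r)) (λ j → φ (n ↑ʳ combine i j))
    hyperedgesIn-cong : hyperedgesIn Preserves _≗_ ⟶ _≡_
    hyperedgesIn-cong {φ} φ≗φ′ = ∏-cong (allFin E) λ i →
      trans (cong₂ (λ a b → edgeThrough a b λ j → φ (n ↑ʳ combine i j)) (φ≗φ′ _) (φ≗φ′ _))
            (edgeThrough-cong _ _ (φ≗φ′ ∘ (n ↑ʳ_) ∘ combine i))

-- toℚ m = + m / 1 is, by definition, fromℚᵘ (ℕ→ℚᵘ m).
ℕ→ℚᵘ : ℕ → ℚᵘ
ℕ→ℚᵘ m = mkℚᵘ (ℤ.+ m) 0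

fromℚᵘ-homo-+ : ∀ p q → fromℚᵘ (p ℚᵘ.+ q) ≡ fromℚᵘ p ℚ.+ fromℚᵘ q
fromℚᵘ-homo-+ p q = ℚ.toℚᵘ-injective (ℚᵘ.≃-trans (ℚ.toℚᵘ-fromℚᵘ (p ℚᵘ.+ q)) (ℚᵘ.≃-sym
  (ℚᵘ.≃-trans (ℚ.toℚᵘ-homo-+ (fromℚᵘ p) (fromℚᵘ q)) (ℚᵘ.+-cong (ℚ.toℚᵘ-fromℚᵘ p) (ℚ.toℚᵘ-fromℚᵘ q)))))

fromℚᵘ-homo-* : ∀ p q → fromℚᵘ (p ℚᵘ.* q) ≡ fromℚᵘ p ℚ.* fromℚᵘ q
fromℚᵘ-homo-* p q = ℚ.toℚᵘ-injective (ℚᵘ.≃-trans (ℚ.toℚᵘ-fromℚᵘ (p ℚᵘ.* q)) (ℚᵘ.≃-sym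
  (ℚᵘ.≃-trans (ℚ.toℚᵘ-homo-* (fromℚᵘ p) (fromℚᵘ q)) (ℚᵘ.*-cong (ℚ.toℚᵘ-fromℚᵘ p) (ℚ.toℚᵘ-fromℚᵘ q)))))

toℚ-+ : ∀ m n → toℚ (m + n) ≡ toℚ m ℚ.+ toℚ n
toℚ-+ m n = trans
  (ℚ.fromℚᵘ-cong {ℕ→ℚᵘ (m + n)} {ℕ→ℚᵘ m ℚᵘ.+ ℕ→ℚᵘ n} (*≡* (cong (ℤ._* ℤ.+ 1) (trans (ℤ.pos-+ m n)
    (sym (cong₂ ℤ._+_ (ℤ.*-identityʳ (ℤ.+ m)) (ℤ.*-identityʳ (ℤ.+ n))))))))
  (fromℚᵘ-homo-+ (ℕ→ℚᵘ m) (ℕ→ℚᵘ n))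

toℚ-* : ∀ m n → toℚ (m * n) ≡ toℚ m ℚ.* toℚ n
toℚ-* m n = trans
  (ℚ.fromℚᵘ-cong {ℕ→ℚᵘ (m * n)} {ℕ→ℚᵘ m ℚᵘ.* ℕ→ℚᵘ n} (*≡* (cong (ℤ._* ℤ.+ 1) (ℤ.pos-* m n))))
  (fromℚᵘ-homo-* (ℕ→ℚᵘ m) (ℕ→ℚᵘ n))

toℚ-*-/ : ∀ k c d .{{_ : NonZero d}} → toℚ (k * d) ℚ.* (ℤ.+ c / d) ≡ toℚ (c * k)
toℚ-*-/ k c (suc d) = trans (sym (fromℚᵘ-homo-* (ℕ→ℚᵘ (k * suc d)) (mkℚᵘ (ℤ.+ c) d)))
  (ℚ.fromℚᵘ-cong {ℕ→ℚᵘ (k * suc d) ℚᵘ.* mkℚᵘ (ℤ.+ c) d} {ℕ→ℚᵘ (c * k)} (*≡* (begin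
    ℤ.+ (k * suc d) ℤ.* ℤ.+ c ℤ.* ℤ.+ 1  ≡⟨ cong (ℤ._* ℤ.+ 1) (ℤ.pos-* (k * suc d) c) ⟨
    ℤ.+ (k * suc d * c) ℤ.* ℤ.+ 1      ≡⟨ ℤ.pos-* (k * suc d * c) 1 ⟨
    ℤ.+ (k * suc d * c * 1)            ≡⟨ cong ℤ.+_ (solve 3 (λ k d c → k :* (con 1 :+ d) :* c :* con 1
                                                      := c :* k :* (con 1 :* (con 1 :+ d))) refl k d c) ⟩
    ℤ.+ (c * k * (1 * suc d))          ≡⟨ ℤ.pos-* (c * k) (1 * suc d) ⟩
    ℤ.+ (c * k) ℤ.* ℤ.+ (1 * suc d)    ∎)))
  where open ≡-Reasoning

toℚ-∑ : ∀ {A : Set} (xs : List A) (f : A → ℕ) → toℚ (∑ xs f) ≡ foldr ℚ._+_ 0ℚ (map (toℚ ∘ f) xs)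
toℚ-∑ []       f = refl
toℚ-∑ (x ∷ xs) f = trans (toℚ-+ (f x) _) (cong (toℚ (f x) ℚ.+_) (toℚ-∑ xs f))

toℚ-∏ : ∀ {A : Set} (xs : List A) (f : A → ℕ) → toℚ (∏ xs f) ≡ foldr ℚ._*_ 1ℚ (map (toℚ ∘ f) xs)
toℚ-∏ []       f = refl
toℚ-∏ (x ∷ xs) f = trans (toℚ-* (f x) _) (cong (toℚ (f x) ℚ.*_) (toℚ-∏ xs f))

*-distribˡ-foldr-+ : ∀ {A : Set} c xs (g : A → ℚ) →
  c ℚ.* foldr ℚ._+_ 0ℚ (map g xs) ≡ foldr ℚ._+_ 0ℚ (map (λ x → c ℚ.* g x) xs)
*-distribˡ-foldr-+ c []       g = ℚ.*-zeroʳ c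
*-distribˡ-foldr-+ c (x ∷ xs) g =
  trans (ℚ.*-distribˡ-+ c (g x) _) (cong (c ℚ.* g x ℚ.+_) (*-distribˡ-foldr-+ c xs g))

foldr-*-scale : ∀ {A : Set} k xs (g : A → ℚ) →
  foldr ℚ._*_ 1ℚ (map (λ x → toℚ k ℚ.* g x) xs) ≡ toℚ (k ^ length xs) ℚ.* foldr ℚ._*_ 1ℚ (map g xs)
foldr-*-scale k []       g = sym (ℚ.*-identityˡ 1ℚ)
foldr-*-scale k (x ∷ xs) g = begin
  (toℚ k ℚ.* g x) ℚ.* foldr ℚ._*_ 1ℚ (map (λ x → toℚ k ℚ.* g x) xs)
    ≡⟨ cong ((toℚ k ℚ.* g x) ℚ.*_) (foldr-*-scale k xs g) ⟩
  (toℚ k ℚ.* g x) ℚ.* (toℚ (k ^ length xs) ℚ.* foldr ℚ._*_ 1ℚ (map g xs))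
    ≡⟨ interchange (toℚ k) (g x) _ _ ⟩
  (toℚ k ℚ.* toℚ (k ^ length xs)) ℚ.* (g x ℚ.* foldr ℚ._*_ 1ℚ (map g xs))
    ≡⟨ cong (ℚ._* (g x ℚ.* foldr ℚ._*_ 1ℚ (map g xs))) (toℚ-* k (k ^ length xs)) ⟨
  toℚ (k ^ length (x ∷ xs)) ℚ.* foldr ℚ._*_ 1ℚ (map g (x ∷ xs)) ∎
  where
  open ≡-Reasoning
  open CommutativeSemigroupProperties (CommutativeMonoid.commutativeSemigroup ℚ.*-1-commutativeMonoid)
    using (interchange)

toℚ-homWℕ : ∀ (F : SimpleGraph) N (w : Fin N → Fin N → ℕ) k (A : Fin N → Fin N → ℚ) →
  (∀ a b → toℚ (w a b) ≡ toℚ k ℚ.* A a b) →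
  toℚ (homWℕ F N w) ≡ toℚ (k ^ length (gedges F)) ℚ.* homW F N A
toℚ-homWℕ F N w k A w≡k*A = begin
  toℚ (homWℕ F N w)
    ≡⟨ toℚ-∑ (allFuns (gv F) N) ∏w ⟩
  foldr ℚ._+_ 0ℚ (map (toℚ ∘ ∏w) (allFuns (gv F) N))
    ≡⟨ cong (foldr ℚ._+_ 0ℚ) (List.map-cong toℚ-∏w (allFuns (gv F) N)) ⟩
  foldr ℚ._+_ 0ℚ (map (λ ψ → toℚ (k ^ length (gedges F)) ℚ.* ∏A ψ) (allFuns (gv F) N))
    ≡⟨ *-distribˡ-foldr-+ (toℚ (k ^ length (gedges F))) (allFuns (gv F) N) ∏A ⟨
  toℚ (k ^ length (gedges F)) ℚ.* homW F N A ∎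
  where
  open ≡-Reasoning
  ∏w : (Fin (gv F) → Fin N) → ℕ
  ∏w ψ = ∏[ e ∈ gedges F ] w (ψ (proj₁ e)) (ψ (proj₂ e))
  ∏A : (Fin (gv F) → Fin N) → ℚ
  ∏A ψ = foldr ℚ._*_ 1ℚ (map (λ e → A (ψ (proj₁ e)) (ψ (proj₂ e))) (gedges F))
  toℚ-∏w : ∀ ψ → toℚ (∏w ψ) ≡ toℚ (k ^ length (gedges F)) ℚ.* ∏A ψ
  toℚ-∏w ψ = trans (toℚ-∏ (gedges F) _) (trans
    (cong (foldr ℚ._*_ 1ℚ) (List.map-cong (λ e → w≡k*A (ψ (proj₁ e)) (ψ (proj₂ e))) (gedges F)))
    (foldr-*-scale k (gedges F) λ e → A (ψ (proj₁ e)) (ψ (proj₂ e))))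

toℚ-offDiagonal*r! : ∀ r N (c : Fin N → Fin N → ℕ) a b →
  toℚ (offDiagonal c a b * r !) ≡ toℚ (r ! * N ^ r) ℚ.* sectionWeights N r c a b
toℚ-offDiagonal*r! r (suc n) c a b with a Fin.≟ b
... | yes _ = sym (ℚ.*-zeroʳ (toℚ (r ! * suc n ^ r)))
... | no  _ = sym (toℚ-*-/ (r !) (c a b) (suc n ^ r) {{m^n≢0 (suc n) r}})

mainTheorem3 : (r : ℕ) (F : SimpleGraph) (H : Hypergraph) →
    IsHypergraph H → Uniform (r + 2) H →
    toℚ (homHyp (subdivision r F) H)
      ≡ toℚ (((r !) * (nv H ^ r)) ^ length (gedges F)) Data.Rational.*
          homW F (nv H) (codegSection r H)
mainTheorem3 r F H isH uniform = begin
  toℚ (homHyp (subdivision r F) H)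
    ≡⟨ cong toℚ (homHyp-subdivision r F H isH uniform) ⟩
  toℚ (homWℕ F (nv H) (λ a b → offDiagonal (codeg H) a b * r !))
    ≡⟨ toℚ-homWℕ F (nv H) (λ a b → offDiagonal (codeg H) a b * r !) (r ! * nv H ^ r) (codegSection r H)
                 (toℚ-offDiagonal*r! r (nv H) (codeg H)) ⟩
  toℚ ((r ! * nv H ^ r) ^ length (gedges F)) ℚ.* homW F (nv H) (codegSection r H) ∎
  where open ≡-Reasoning
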